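{- Let $\Gamma\le S_m$ and let $a_1,\dots,a_m\ge2$ be integers. Let $O_1,\dots,O_t$ be the orbits of the action of the commutator subgroup $[\Gamma,\Gamma]$ on $[m]$, and for each $i$ let $n_i=\min\{a_j: j\in O_i\}$. Let $\Gamma'\le S_t$ be the permutation group on $\{1,\dots,t\}$ induced by the action of $\Gamma$ (equivalently of $\Gamma/[\Gamma,\Gamma]$) on the set of orbits, i.e. $\sigma\in\Gamma$ induces the permutation $i\mapsto i'$ where $\sigma(O_i)=O_{i'}$. Then \[R_\Gamma(a_1,\dots,a_m)\le R_{\Gamma'}(n_1,n_2,\dots,n_t),\] where the right-hand side is what the paper denotes $R_{\Gamma/[\Gamma,\Gamma]}(n_1,\dots,n_t)$.
   Context: An $m$-edge-coloured complete graph is a complete graph with each edge coloured from $[m]=\{1,\dots,m\}$. For a group $\Delta\le S_m$, $\pi\in\Delta$ and a vertex $v$, switching at $v$ with $\pi$ recolours every edge incident with $v$ of colour $i$ to colour $\pi(i)$, leaving other edges unchanged. Two such graphs on the same vertex set are $\Delta$-switch equivalent if one is obtained from the other by a finite sequence of switches. $K_t^{(i)}$ is a complete graph on $t$ vertices with all edges of colour $i$. $R_\Delta(a_1,\dots,a_m)$ is the least $n$ such that every $m$-edge-coloured complete graph on $n$ vertices is $\Delta$-switch equivalent to one containing, for some $i$, a copy of $K_{a_i}^{(i)}$. Since $[\Gamma,\Gamma]$ is normal in $\Gamma$, $\Gamma$ permutes the $[\Gamma,\Gamma]$-orbits and $[\Gamma,\Gamma]$ acts trivially on them. -}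

module Defs where

open import Data.Nat using (ℕ; _≤_)
open import Data.Fin using (Fin; _≟_)
open import Data.Fin.Permutation using (Permutation′; _⟨$⟩ʳ_; _≈_; id; flip; _∘ₚ_)
open import Data.Product using (Σ; ∃; _×_; _,_)
open import Relation.Binary.PropositionalEquality using (_≡_; _≢_)
open import Relation.Binary.Construct.Closure.ReflexiveTransitive using (Star)
open import Relation.Nullary using (yes; no)
open import Function.Definitions using (Injective)

record IsPermGroup {m : ℕ} (Δ : Permutation′ m → Set) : Set where
  field
    resp : ∀ {π ρ} → π ≈ ρ → Δ π → Δ ρ
    id∈  : Δ id
    ∘∈   : ∀ {π ρ} → Δ π → Δ ρ → Δ (π ∘ₚ ρ)
    ⁻¹∈  : ∀ {π} → Δ π → Δ (flip π)

data Comm {m : ℕ} (Γ : Permutation′ m → Set) : Permutation′ m → Set where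
  comm  : ∀ {g h} → Γ g → Γ h → Comm Γ (((flip g) ∘ₚ (flip h)) ∘ₚ (g ∘ₚ h))
  cid   : Comm Γ id
  ccomp : ∀ {π ρ} → Comm Γ π → Comm Γ ρ → Comm Γ (π ∘ₚ ρ)
  cinv  : ∀ {π} → Comm Γ π → Comm Γ (flip π)
  cresp : ∀ {π ρ} → π ≈ ρ → Comm Γ π → Comm Γ ρ

SameOrbit : ∀ {m} → (Permutation′ m → Set) → Fin m → Fin m → Set
SameOrbit Γ i j = ∃ λ π → Comm Γ π × (π ⟨$⟩ʳ i ≡ j)

-- The permutation group on orbit labels {1..t} induced by Γ, where the
-- [Γ,Γ]-orbits are labelled by orb : Fin m → Fin t:
-- τ is induced by σ ∈ Γ iff σ(O_i) = O_{τ(i)}, i.e. orb (σ j) = τ (orb j).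
Induced : ∀ {m t} → (Permutation′ m → Set) → (Fin m → Fin t) → Permutation′ t → Set
Induced Γ orb τ = ∃ λ σ → Γ σ × (∀ j → τ ⟨$⟩ʳ (orb j) ≡ orb (σ ⟨$⟩ʳ j))

IsOrbitMin : ∀ {m t} → (Fin m → Fin t) → (Fin m → ℕ) → (Fin t → ℕ) → Set
IsOrbitMin orb a n =
  (∀ j → n (orb j) ≤ a j) × (∀ k → ∃ λ j → (orb j ≡ k) × (n k ≡ a j))

-- m-edge-coloured complete graphs on n vertices: a colour for each ordered pair,
-- required to be symmetric (diagonal values are irrelevant).
Colouring : ℕ → ℕ → Set
Colouring n m = Fin n → Fin n → Fin m

SymmetricCol : ∀ {n m} → Colouring n m → Set
SymmetricCol c = ∀ u w → c u w ≡ c w u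

switch : ∀ {n m} → Permutation′ m → Fin n → Colouring n m → Colouring n m
switch π v c u w with u ≟ v | w ≟ v
... | yes _ | no _  = π ⟨$⟩ʳ c u w
... | no _  | yes _ = π ⟨$⟩ʳ c u w
... | _     | _     = c u w

SwitchStep : ∀ {n m} → (Permutation′ m → Set) → Colouring n m → Colouring n m → Set
SwitchStep Δ c d = Σ _ λ π → Δ π × Σ _ λ v → d ≡ switch π v c

SwitchEquiv : ∀ {n m} → (Permutation′ m → Set) → Colouring n m → Colouring n m → Set
SwitchEquiv Δ = Star (SwitchStep Δ)

HasMonoClique : ∀ {n m} → Colouring n m → Fin m → ℕ → Set
HasMonoClique {n} c i k =
  Σ (Fin k → Fin n) λ f → Injective _≡_ _≡_ f × (∀ x y → x ≢ y → c (f x) (f y) ≡ i)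

RamseyProp : ∀ {m} → (Permutation′ m → Set) → (Fin m → ℕ) → ℕ → Set
RamseyProp {m} Δ a n =
  (c : Colouring n m) → SymmetricCol c →
  ∃ λ d → SwitchEquiv Δ c d × ∃ λ i → HasMonoClique d i (a i)

IsLeast : (ℕ → Set) → ℕ → Set
IsLeast P r = P r × (∀ s → P s → r ≤ s)

{-# OPTIONS --safe #-}
module Submission where

-- Project a colouring c onto the [Γ,Γ]-orbits. By the Ramsey property of the induced
-- group, orb ∘ c switches to a colouring with a clique of size n k whose edges all have
-- colour k, and each induced switch lifts to a switch of c by an element of Γ inducing it;
-- so c switches to a colouring whose clique has all its edge colours in the orbit O_k.
-- Switching at u and at w with g⁻¹, h⁻¹, g, h cancels on every edge except uw, where it
-- applies the commutator; hence any element of [Γ,Γ] can be applied to a single edge, and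
-- the clique is recoloured edge by edge to a colour j ∈ O_k with a j = n k.

open import Defs
open import Data.Bool using (Bool; true; false; _∧_; _xor_; if_then_else_)
open import Data.Bool.Properties using (xor-comm; if-eta)
open import Data.Nat using (ℕ; _≤_)
open import Data.Fin using (Fin; _≟_)
open import Data.Fin.Permutation using (Permutation′; _⟨$⟩ʳ_; _⟨$⟩ˡ_; _≈_; flip; inverseʳ; inverseˡ)
open import Data.Product using (∃; _×_; _,_; proj₁)
open import Data.Sum using (_⊎_; inj₁; inj₂; [_,_]′; map)
open import Data.Empty using (⊥-elim)
open import Data.List using ([]; _∷_; cartesianProduct; allFin)
open import Data.List.Membership.Propositional using (_∈_)
open import Data.List.Membership.Propositional.Properties using (∈-allFin; ∈-cartesianProduct⁺)
open import Data.List.Relation.Unary.Any using (here; there)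
open import Function using (_∘_; id)
open import Function.Definitions using (Surjective; Injective)
open import Function.Bundles using (_⇔_; Equivalence)
open import Relation.Binary.PropositionalEquality
  using (_≡_; _≢_; refl; sym; trans; cong; cong₂; subst; module ≡-Reasoning)
open import Relation.Binary.Construct.Closure.ReflexiveTransitive using (ε; _◅_; _◅◅_)
open import Relation.Nullary using (does; yes; no)
open import Relation.Nullary.Decidable using (dec-true; dec-false)

applyWhen : ∀ {A : Set} → Bool → (A → A) → A → A
applyWhen b f z = if b then f z else z

module _ {N : ℕ} where

  incident : Fin N → Fin N → Fin N → Bool
  incident v x y = does (x ≟ v) xor does (y ≟ v)

  incident-sym : ∀ v x y → incident v x y ≡ incident v y x
  incident-sym v x y = xor-comm (does (x ≟ v)) (does (y ≟ v))

  incident-endpoints : ∀ {u w} → u ≢ w → incident u u w ∧ incident w u w ≡ true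
  incident-endpoints {u} {w} u≢w
    rewrite dec-true (u ≟ u) refl | dec-false (w ≟ u) (u≢w ∘ sym)
          | dec-true (w ≟ w) refl | dec-false (u ≟ w) u≢w = refl

  incident-both : ∀ {u w} → u ≢ w → ∀ x y → incident u x y ∧ incident w x y ≡ true →
                  (x ≡ u × y ≡ w) ⊎ (x ≡ w × y ≡ u)
  incident-both {u} {w} u≢w x y both with x ≟ u | y ≟ u | x ≟ w | y ≟ w
  ... | yes x≡u | no _    | _       | yes y≡w = inj₁ (x≡u , y≡w)
  ... | no _    | yes y≡u | yes x≡w | _       = inj₂ (x≡w , y≡u)
  ... | yes x≡u | _       | yes x≡w | _       = ⊥-elim (u≢w (trans (sym x≡u) x≡w))
  ... | _       | yes y≡u | _       | yes y≡w = ⊥-elim (u≢w (trans (sym y≡u) y≡w))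
  incident-both u≢w x y () | yes _ | yes _ | _     | _
  incident-both u≢w x y () | yes _ | no _  | no _  | no _
  incident-both u≢w x y () | no _  | no _  | _     | _
  incident-both u≢w x y () | no _  | yes _ | no _  | no _

module _ {N m : ℕ} where

  switch-incident : ∀ (π : Permutation′ m) v (c : Colouring N m) x y →
                    switch π v c x y ≡ applyWhen (incident v x y) (π ⟨$⟩ʳ_) (c x y)
  switch-incident π v c x y with x ≟ v | y ≟ v
  ... | yes _ | yes _ = refl
  ... | yes _ | no _  = refl
  ... | no _  | yes _ = refl
  ... | no _  | no _  = refl

  switch-symmetric : ∀ (π : Permutation′ m) v {c : Colouring N m} →
                     SymmetricCol c → SymmetricCol (switch π v c)
  switch-symmetric π v {c} c-sym x y = begin
    switch π v c x y                                  ≡⟨ switch-incident π v c x y ⟩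
    applyWhen (incident v x y) (π ⟨$⟩ʳ_) (c x y)      ≡⟨ cong₂ (λ b z → applyWhen b (π ⟨$⟩ʳ_) z)
                                                               (incident-sym v x y) (c-sym x y) ⟩
    applyWhen (incident v y x) (π ⟨$⟩ʳ_) (c y x)      ≡⟨ switch-incident π v c y x ⟨
    switch π v c y x                                  ∎
    where open ≡-Reasoning

  switchEquiv-symmetric : ∀ {Δ} {c d : Colouring N m} →
                          SwitchEquiv Δ c d → SymmetricCol c → SymmetricCol d
  switchEquiv-symmetric ε                          c-sym = c-sym
  switchEquiv-symmetric ((π , _ , v , refl) ◅ c⇝d) c-sym =
    switchEquiv-symmetric c⇝d (switch-symmetric π v c-sym)

module _ {N m : ℕ} (Γ : Permutation′ m → Set) where

  -- For u ≢ w, the condition incident u x y ∧ incident w x y singles out the edge uw.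
  EdgeRecolourable : (Fin m → Fin m) → Set
  EdgeRecolourable φ = ∀ (c : Colouring N m) u w → ∃ λ d → SwitchEquiv Γ c d ×
    (∀ x y → d x y ≡ applyWhen (incident u x y ∧ incident w x y) φ (c x y))

  edgeRecolourable-id : EdgeRecolourable id
  edgeRecolourable-id c u w = c , ε , λ x y → sym (if-eta (incident u x y ∧ incident w x y))

  edgeRecolourable-∘ : ∀ {φ ψ} → EdgeRecolourable φ → EdgeRecolourable ψ →
                       EdgeRecolourable (ψ ∘ φ)
  edgeRecolourable-∘ {φ} {ψ} φ-rec ψ-rec c u w with φ-rec c u w
  ... | d , c⇝d , d≡ with ψ-rec d u w
  ...   | e , d⇝e , e≡ =
    e , c⇝d ◅◅ d⇝e , λ x y → trans (e≡ x y) (compose (incident u x y ∧ incident w x y) (d≡ x y))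
    where
    compose : ∀ b {z z′} → z′ ≡ applyWhen b φ z → applyWhen b ψ z′ ≡ applyWhen b (ψ ∘ φ) z
    compose true  refl = refl
    compose false refl = refl

  edgeRecolourable-resp : ∀ {φ ψ} → (∀ z → φ z ≡ ψ z) →
                          EdgeRecolourable φ → EdgeRecolourable ψ
  edgeRecolourable-resp {φ} {ψ} φ≗ψ φ-rec c u w with φ-rec c u w
  ... | d , c⇝d , d≡ = d , c⇝d , λ x y → trans (d≡ x y) (resp (incident u x y ∧ incident w x y))
    where
    resp : ∀ b {z} → applyWhen b φ z ≡ applyWhen b ψ z
    resp true  = φ≗ψ _
    resp false = refl

≈-inverse : ∀ {m} {π ρ : Permutation′ m} → π ≈ ρ → ∀ z → π ⟨$⟩ˡ z ≡ ρ ⟨$⟩ˡ z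
≈-inverse {π = π} {ρ} π≈ρ z = begin
  π ⟨$⟩ˡ z                    ≡⟨ cong (π ⟨$⟩ˡ_) (inverseʳ ρ) ⟨
  π ⟨$⟩ˡ (ρ ⟨$⟩ʳ (ρ ⟨$⟩ˡ z))  ≡⟨ cong (π ⟨$⟩ˡ_) (π≈ρ (ρ ⟨$⟩ˡ z)) ⟨
  π ⟨$⟩ˡ (π ⟨$⟩ʳ (ρ ⟨$⟩ˡ z))  ≡⟨ inverseˡ π ⟩
  ρ ⟨$⟩ˡ z                    ∎
  where open ≡-Reasoning

module _ {N m : ℕ} {Γ : Permutation′ m → Set} (Γ-group : IsPermGroup Γ) where
  open IsPermGroup Γ-group using (⁻¹∈)

  commutator-edgeRecolourable : ∀ {g h} → Γ g → Γ h →
    EdgeRecolourable {N} Γ (λ z → h ⟨$⟩ʳ (g ⟨$⟩ʳ (h ⟨$⟩ˡ (g ⟨$⟩ˡ z))))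
  commutator-edgeRecolourable {g} {h} g∈Γ h∈Γ c u w =
    c₄ , (flip g , ⁻¹∈ g∈Γ , u , refl) ◅ (flip h , ⁻¹∈ h∈Γ , w , refl)
       ◅ (g , g∈Γ , u , refl) ◅ (h , h∈Γ , w , refl) ◅ ε , c₄≡
    where
    c₁ c₂ c₃ c₄ : Colouring N m
    c₁ = switch (flip g) u c
    c₂ = switch (flip h) w c₁
    c₃ = switch g u c₂
    c₄ = switch h w c₃

    cancel : ∀ a b {z} →
      applyWhen b (h ⟨$⟩ʳ_) (applyWhen a (g ⟨$⟩ʳ_) (applyWhen b (h ⟨$⟩ˡ_) (applyWhen a (g ⟨$⟩ˡ_) z)))
        ≡ applyWhen (a ∧ b) (λ z → h ⟨$⟩ʳ (g ⟨$⟩ʳ (h ⟨$⟩ˡ (g ⟨$⟩ˡ z)))) z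
    cancel true  true  = refl
    cancel true  false = inverseʳ g
    cancel false true  = inverseʳ h
    cancel false false = refl

    c₄≡ : ∀ x y → c₄ x y ≡ applyWhen (incident u x y ∧ incident w x y)
                                      (λ z → h ⟨$⟩ʳ (g ⟨$⟩ʳ (h ⟨$⟩ˡ (g ⟨$⟩ˡ z)))) (c x y)
    c₄≡ x y = begin
      c₄ x y                    ≡⟨ switch-incident h w c₃ x y ⟩
      H (c₃ x y)                ≡⟨ cong H (switch-incident g u c₂ x y) ⟩
      H (G (c₂ x y))            ≡⟨ cong (H ∘ G) (switch-incident (flip h) w c₁ x y) ⟩
      H (G (H⁻¹ (c₁ x y)))      ≡⟨ cong (H ∘ G ∘ H⁻¹) (switch-incident (flip g) u c x y) ⟩
      H (G (H⁻¹ (G⁻¹ (c x y)))) ≡⟨ cancel (incident u x y) (incident w x y) ⟩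
      _                         ∎
      where
      open ≡-Reasoning
      G G⁻¹ H H⁻¹ : Fin m → Fin m
      G   = applyWhen (incident u x y) (g ⟨$⟩ʳ_)
      G⁻¹ = applyWhen (incident u x y) (g ⟨$⟩ˡ_)
      H   = applyWhen (incident w x y) (h ⟨$⟩ʳ_)
      H⁻¹ = applyWhen (incident w x y) (h ⟨$⟩ˡ_)

  commutatorSubgroup-edgeRecolourable : ∀ {π} → Comm Γ π →
    EdgeRecolourable {N} Γ (π ⟨$⟩ʳ_) × EdgeRecolourable {N} Γ (π ⟨$⟩ˡ_)
  commutatorSubgroup-edgeRecolourable (comm g∈Γ h∈Γ) =
    commutator-edgeRecolourable g∈Γ h∈Γ , commutator-edgeRecolourable h∈Γ g∈Γ
  commutatorSubgroup-edgeRecolourable cid =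
    edgeRecolourable-id Γ , edgeRecolourable-id Γ
  commutatorSubgroup-edgeRecolourable (ccomp {π} {ρ} π∈ ρ∈)
    with commutatorSubgroup-edgeRecolourable π∈ | commutatorSubgroup-edgeRecolourable ρ∈
  ... | π-rec , π⁻¹-rec | ρ-rec , ρ⁻¹-rec =
    edgeRecolourable-∘ Γ {π ⟨$⟩ʳ_} {ρ ⟨$⟩ʳ_} π-rec ρ-rec ,
    edgeRecolourable-∘ Γ {ρ ⟨$⟩ˡ_} {π ⟨$⟩ˡ_} ρ⁻¹-rec π⁻¹-rec
  commutatorSubgroup-edgeRecolourable (cinv π∈) with commutatorSubgroup-edgeRecolourable π∈
  ... | π-rec , π⁻¹-rec = π⁻¹-rec , π-rec
  commutatorSubgroup-edgeRecolourable (cresp {π} {ρ} π≈ρ π∈) with commutatorSubgroup-edgeRecolourable π∈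
  ... | π-rec , π⁻¹-rec =
    edgeRecolourable-resp Γ {π ⟨$⟩ʳ_} {ρ ⟨$⟩ʳ_} π≈ρ π-rec ,
    edgeRecolourable-resp Γ {π ⟨$⟩ˡ_} {ρ ⟨$⟩ˡ_} (≈-inverse {π = π} {ρ} π≈ρ) π⁻¹-rec

module _ {N m : ℕ} where

  RecolouredTo : Fin m → Colouring N m → Colouring N m → Set
  RecolouredTo j c d = ∀ x y → d x y ≡ j ⊎ d x y ≡ c x y

  recolouredTo-refl : ∀ {j c} → RecolouredTo j c c
  recolouredTo-refl _ _ = inj₂ refl

  recolouredTo-trans : ∀ {j c d e} → RecolouredTo j c d → RecolouredTo j d e → RecolouredTo j c e
  recolouredTo-trans c→d d→e x y =
    [ inj₁ , (λ e≡d → map (trans e≡d) (trans e≡d) (c→d x y)) ]′ (d→e x y)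

  recolouredTo-stable : ∀ {j c d} → RecolouredTo j c d → ∀ {x y} → c x y ≡ j → d x y ≡ j
  recolouredTo-stable c→d {x} {y} c≡j = [ id , (λ d≡c → trans d≡c c≡j) ]′ (c→d x y)

  recolouredTo-orbit : ∀ {t} (orb : Fin m → Fin t) {j c d} → RecolouredTo j c d →
                       ∀ {x y} → orb (c x y) ≡ orb j → orb (d x y) ≡ orb j
  recolouredTo-orbit orb c→d {x} {y} c∼j =
    [ cong orb , (λ d≡c → trans (cong orb d≡c) c∼j) ]′ (c→d x y)

module _ {N m t : ℕ} {Γ : Permutation′ m → Set} (Γ-group : IsPermGroup Γ)
         (orb : Fin m → Fin t) (orb-iff : ∀ i j → (orb i ≡ orb j) ⇔ SameOrbit Γ i j)
         (j : Fin m) where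

  recolourEdge : ∀ {c : Colouring N m} {u w} → SymmetricCol c → u ≢ w → orb (c u w) ≡ orb j →
                 ∃ λ d → SwitchEquiv Γ c d × RecolouredTo j c d × d u w ≡ j
  recolourEdge {c} {u} {w} c-sym u≢w cuw∼j with Equivalence.to (orb-iff (c u w) j) cuw∼j
  ... | π , π∈ , πcuw≡j with proj₁ (commutatorSubgroup-edgeRecolourable Γ-group π∈) c u w
  ...   | d , c⇝d , d≡ = d , c⇝d , recoloured , duw≡j
    where
    πc≡j : ∀ {x y} → (x ≡ u × y ≡ w) ⊎ (x ≡ w × y ≡ u) → π ⟨$⟩ʳ c x y ≡ j
    πc≡j (inj₁ (refl , refl)) = πcuw≡j
    πc≡j (inj₂ (refl , refl)) = trans (cong (π ⟨$⟩ʳ_) (c-sym w u)) πcuw≡j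

    recoloured : RecolouredTo j c d
    recoloured x y with incident u x y ∧ incident w x y in both | d≡ x y
    ... | false | d≡c  = inj₂ d≡c
    ... | true  | d≡πc = inj₁ (trans d≡πc (πc≡j (incident-both u≢w x y both)))

    duw≡j : d u w ≡ j
    duw≡j = begin
      d u w                                                        ≡⟨ d≡ u w ⟩
      applyWhen (incident u u w ∧ incident w u w) (π ⟨$⟩ʳ_) (c u w) ≡⟨ cong (λ b → applyWhen b (π ⟨$⟩ʳ_) (c u w))
                                                                           (incident-endpoints u≢w) ⟩
      π ⟨$⟩ʳ c u w                                                 ≡⟨ πcuw≡j ⟩
      j                                                            ∎
      where open ≡-Reasoning

  recolourClique : ∀ {s} {c : Colouring N m} (f : Fin s → Fin N) → Injective _≡_ _≡_ f →
                   SymmetricCol c → (∀ x y → x ≢ y → orb (c (f x) (f y)) ≡ orb j) →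
                   ∃ λ d → SwitchEquiv Γ c d × HasMonoClique d j s
  recolourClique {s} {c} f f-inj c-sym c∼j =
    let d , c⇝d , _ , done = recolourEdges (cartesianProduct (allFin s) (allFin s))
    in  d , c⇝d , f , f-inj , λ x y → done (∈-cartesianProduct⁺ (∈-allFin x) (∈-allFin y))
    where
    recolourEdges : ∀ L → ∃ λ d → SwitchEquiv Γ c d × RecolouredTo j c d ×
                      (∀ {x y} → (x , y) ∈ L → x ≢ y → d (f x) (f y) ≡ j)
    recolourEdges [] = c , ε , recolouredTo-refl , λ ()
    recolourEdges ((x , y) ∷ L) with recolourEdges L | x ≟ y
    ... | d , c⇝d , c→d , done | yes x≡y =
      d , c⇝d , c→d , λ { (here refl) x≢y → ⊥-elim (x≢y x≡y) ; (there p) → done p }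
    ... | d , c⇝d , c→d , done | no x≢y
      with recolourEdge (switchEquiv-symmetric c⇝d c-sym) (x≢y ∘ f-inj)
                        (recolouredTo-orbit orb c→d (c∼j x y x≢y))
    ...   | e , d⇝e , d→e , e≡j =
      e , c⇝d ◅◅ d⇝e , recolouredTo-trans c→d d→e ,
      λ { (here refl) _ → e≡j ; (there p) x≢y → recolouredTo-stable d→e (done p x≢y) }

module _ {N m t : ℕ} {Γ : Permutation′ m → Set} (orb : Fin m → Fin t) where

  LiesOver : Colouring N m → Colouring N t → Set
  LiesOver c c′ = ∀ x y → orb (c x y) ≡ c′ x y

  switch-liesOver : ∀ {σ τ} → (∀ z → τ ⟨$⟩ʳ orb z ≡ orb (σ ⟨$⟩ʳ z)) → ∀ v {c c′} →
                    LiesOver c c′ → LiesOver (switch σ v c) (switch τ v c′)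
  switch-liesOver {σ} {τ} τ∼σ v {c} {c′} c/c′ x y = begin
    orb (switch σ v c x y)                   ≡⟨ cong orb (switch-incident σ v c x y) ⟩
    orb (applyWhen b (σ ⟨$⟩ʳ_) (c x y))      ≡⟨ commute b ⟩
    applyWhen b (τ ⟨$⟩ʳ_) (orb (c x y))      ≡⟨ cong (applyWhen b (τ ⟨$⟩ʳ_)) (c/c′ x y) ⟩
    applyWhen b (τ ⟨$⟩ʳ_) (c′ x y)           ≡⟨ switch-incident τ v c′ x y ⟨
    switch τ v c′ x y                        ∎
    where
    open ≡-Reasoning
    b : Bool
    b = incident v x y
    commute : ∀ b {z} → orb (applyWhen b (σ ⟨$⟩ʳ_) z) ≡ applyWhen b (τ ⟨$⟩ʳ_) (orb z)
    commute true  = sym (τ∼σ _)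
    commute false = refl

  liftSwitchEquiv : ∀ {c′ d′} → SwitchEquiv (Induced Γ orb) c′ d′ → ∀ c → LiesOver c c′ →
                    ∃ λ d → SwitchEquiv Γ c d × LiesOver d d′
  liftSwitchEquiv ε c c/c′ = c , ε , c/c′
  liftSwitchEquiv ((τ , (σ , σ∈Γ , τ∼σ) , v , refl) ◅ c′⇝d′) c c/c′ =
    let d , c⇝d , d/d′ = liftSwitchEquiv c′⇝d′ (switch σ v c) (switch-liesOver τ∼σ v c/c′)
    in  d , (σ , σ∈Γ , v , refl) ◅ c⇝d , d/d′

lemma10 : (m : ℕ) (Γ : Permutation′ m → Set) → IsPermGroup Γ →
          (a : Fin m → ℕ) → (∀ j → 2 ≤ a j) →
          (t : ℕ) (orb : Fin m → Fin t) → Surjective _≡_ _≡_ orb →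
          (∀ i j → (orb i ≡ orb j) ⇔ SameOrbit Γ i j) →
          (n : Fin t → ℕ) → IsOrbitMin orb a n →
          (r r′ : ℕ) → IsLeast (RamseyProp Γ a) r →
          IsLeast (RamseyProp (Induced Γ orb) n) r′ →
          r ≤ r′
lemma10 m Γ Γ-group a _ t orb _ orb-iff n (_ , n-attained) r r′ (_ , r-least) (r′-ramsey , _) =
  r-least r′ ramsey
  where
  ramsey : RamseyProp Γ a r′
  ramsey c c-sym =
    let d′ , c′⇝d′ , k , f , f-inj , d′-clique =
          r′-ramsey (λ x y → orb (c x y)) (λ x y → cong orb (c-sym x y))
        d , c⇝d , d/d′ = liftSwitchEquiv {Γ = Γ} orb c′⇝d′ c (λ _ _ → refl)
        j , orb-j≡k , nk≡aj = n-attained k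
        e , d⇝e , e-clique =
          recolourClique Γ-group orb orb-iff j f f-inj (switchEquiv-symmetric c⇝d c-sym)
            (λ x y x≢y → trans (trans (d/d′ (f x) (f y)) (d′-clique x y x≢y)) (sym orb-j≡k))
    in  e , c⇝d ◅◅ d⇝e , j , subst (HasMonoClique e j) nk≡aj e-clique
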